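{- Work in $\mathrm{ZF}^-$. For every $n<\omega$ the limit $$\Pr(S_{\omega,n})=\lim_{m\to\omega}\frac{|S_{\omega,n}\cap V_m|}{|V_m|}$$ exists, and $\Pr(S_{\omega,1})=\Pr(S_{\omega,3})=1/2$, while $\Pr(S_{\omega,n})=0$ for all other $n<\omega$.
   Context: $\mathrm{ZF}^-$ is ZF without the Axiom of Regularity. $V_m$ ($m<\omega$) are the finite levels of the cumulative hierarchy ($V_0=\emptyset$, $V_{m+1}=\mathcal P(V_m)$), $V_\omega=\bigcup_m V_m$. For a set $x$, consider the game: player I chooses $x_0\in x$, then II chooses $x_1\in x_0$, then I chooses $x_2\in x_1$, etc.; a player who cannot move (current set empty) loses. Define by recursion on ordinals $\gamma$: a set is $2\gamma$-winning if each of its elements is $(2\delta+1)$-winning for some $\delta<\gamma$; a set is $(2\gamma+1)$-winning if some element of it is $2\gamma$-winning. Let $W_\nu$ be the class of $\nu$-winning sets, $S_\nu=W_\nu\setminus\bigcup_{\mu<\nu}W_\mu$, and $S_{\alpha,\nu}=V_\alpha\cap S_\nu$. -}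

module Defs where

open import Data.Nat using (ℕ; zero; suc; _+_; _^_; _/_; _%_; _≡ᵇ_; _<_)
open import Data.Bool using (Bool; true; false; if_then_else_)
open import Data.Fin using (Fin; toℕ)
open import Data.Fin.Properties using (all?; any?)
open import Data.Product using (Σ; _×_; _,_; ∃)
open import Data.Sum using (_⊎_; inj₁; inj₂)
open import Data.Empty using (⊥)
open import Data.Integer using (+_)
open import Data.Rational using (ℚ; 0ℚ) renaming (_/_ to _/ℚ_)
open import Data.Rational using (_-_; ∣_∣) renaming (_<_ to _<ℚ_)
open import Relation.Nullary using (Dec; yes; no; ¬_)
open import Relation.Nullary.Decidable using (⌊_⌋; _×-dec_; _⊎-dec_; ¬?)
open import Relation.Binary.PropositionalEquality using (_≡_)
open import Data.Bool.Properties using () renaming (_≟_ to _≟B_)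

-- Hereditarily finite sets V_ω via the Ackermann coding:
-- the natural number y codes the set { x : bit x of y is 1 }.
-- This is a bijection ℕ ≅ V_ω, and (standardly) V_m corresponds
-- exactly to the numbers below tower m, where
-- tower 0 = 0 and tower (m+1) = 2 ^ tower m  (so |V_m| = tower m).

bit : ℕ → ℕ → Bool
bit y zero    = y % 2 ≡ᵇ 1
bit y (suc x) = bit (y / 2) x

_∈ₕ_ : ℕ → ℕ → Set
x ∈ₕ y = bit y x ≡ true

tower : ℕ → ℕ
tower zero    = 0
tower (suc m) = 2 ^ tower m

-- ν-winning sets for finite ν (only finite ordinals are relevant for
-- ν < ω).  Every element x of (the set coded by) y satisfies x < y,
-- so quantifying over elements of y means quantifying over Fin y.
--   WinE k y : y is (2k)-winning
--   WinO k y : y is (2k+1)-winning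
--   AnyO k y : y is (2δ+1)-winning for some δ < k

mutual
  WinE : ℕ → ℕ → Set
  WinE k y = (x : Fin y) → toℕ x ∈ₕ y → AnyO k (toℕ x)

  WinO : ℕ → ℕ → Set
  WinO k y = Σ (Fin y) λ x → (toℕ x ∈ₕ y) × WinE k (toℕ x)

  AnyO : ℕ → ℕ → Set
  AnyO zero    x = ⊥
  AnyO (suc k) x = AnyO k x ⊎ WinO k x

Win : ℕ → ℕ → Set
Win n y = if n % 2 ≡ᵇ 0 then WinE (n / 2) y else WinO (n / 2) y

S : ℕ → ℕ → Set
S n y = Win n y × ((μ : Fin n) → ¬ Win (toℕ μ) y)

∈ₕ? : (x y : ℕ) → Dec (x ∈ₕ y)
∈ₕ? x y = bit y x ≟B true

mutual
  WinE? : (k y : ℕ) → Dec (WinE k y)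
  WinE? k y = all? λ x → ¬? (∈ₕ? (toℕ x) y) ⊎→ AnyO? k (toℕ x)
    where
    _⊎→_ : ∀ {A B : Set} → Dec (¬ A) → Dec B → Dec (A → B)
    (yes ¬a ⊎→ _) = yes λ a → Data.Empty.⊥-elim (¬a a)
    (no ¬¬a ⊎→ yes b) = yes λ _ → b
    (no ¬¬a ⊎→ no ¬b) = no λ f → ¬¬a λ a → ¬b (f a)

  WinO? : (k y : ℕ) → Dec (WinO k y)
  WinO? k y = any? λ x → ∈ₕ? (toℕ x) y ×-dec WinE? k (toℕ x)

  AnyO? : (k y : ℕ) → Dec (AnyO k y)
  AnyO? zero    y = no λ ()
  AnyO? (suc k) y = AnyO? k y ⊎-dec WinO? k y

Win? : (n y : ℕ) → Dec (Win n y)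
Win? n y with n % 2 ≡ᵇ 0
... | true  = WinE? (n / 2) y
... | false = WinO? (n / 2) y

S? : (n y : ℕ) → Dec (S n y)
S? n y = Win? n y ×-dec all? (λ μ → ¬? (Win? (toℕ μ) y))

countS : ℕ → ℕ → ℕ
countS n zero    = 0
countS n (suc N) = countS n N + (if ⌊ S? n N ⌋ then 1 else 0)

-- a / d as a rational (with the harmless convention a / 0 = 0)
frac : ℕ → ℕ → ℚ
frac a zero    = 0ℚ
frac a (suc d) = (+ a) /ℚ (suc d)

ratio : ℕ → ℕ → ℚ
ratio n m = frac (countS n (tower m)) (tower m)

Tends : (ℕ → ℚ) → ℚ → Set
Tends f L = (ε : ℚ) → 0ℚ <ℚ ε → ∃ λ M → (m : ℕ) → M Data.Nat.≤ m → ∣ f m - L ∣ <ℚ ε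

-- A set is 1-winning iff it contains ∅, so S₁ is exactly half of every
-- V (m + 1) = P (V m).  A set y with a 2-winning element x is 3-winning but
-- neither 0-winning (it is nonempty) nor 2-winning (x would also have to be
-- 1-winning, and no set is both 1- and 2-winning); so y lies in S₁ if ∅ ∈ y
-- and in S₃ otherwise.  The subsets of V m without 2-winning elements make up
-- the fraction 2 ^ -k of P (V m), where k is the number of 2-winning sets in
-- V m, and k → ∞ because every singleton {2j+1} is 2-winning.  Hence S₃ has
-- density ½ - O(2 ^ -k), and every S n with n ∉ {1, 3} density O(2 ^ -k).

module Submission where

open import Defs
open import Data.Bool using (Bool; true; false; not; _∧_; if_then_else_; T)
open import Data.Bool.Properties using (T-not-≡; not-¬; ¬-not)
open import Data.Empty using (⊥-elim)
open import Data.Fin using (toℕ; fromℕ<; zero; suc)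
open import Data.Fin.Properties using (toℕ-fromℕ<)
open import Data.Integer as ℤ using (+[1+_]; -[1+_]; _⊖_)
import Data.Integer.Properties as ℤP
open import Data.Nat using (ℕ; zero; suc; _+_; _*_; _^_; _/_; _%_; _∸_; _≤_; _<_; z≤n; s≤s; s≤s⁻¹; ∣_-_∣; _≡ᵇ_; ≢-nonZero)
open import Data.Nat.Coprimality using (Coprime)
open import Data.Nat.Divisibility using (divides-refl)
open import Data.Nat.DivMod using (m*n%n≡0; [m+kn]%n≡m%n; m*n/n≡m; +-distrib-/-∣ʳ; m/n*n≤m; m/n<m; m≡m%n+[m/n]*n; m%n<n)
open import Data.Nat.Induction using (<-wellFounded)
open import Data.Nat.Properties
open import Algebra.Properties.CommutativeSemigroup +-commutativeSemigroup using (interchange)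
open import Algebra.Properties.CommutativeSemigroup *-commutativeSemigroup as *-Comm using ()
open import Data.Product using (∃; _×_; _,_; proj₁; proj₂)
import Data.Product as Product
open import Data.Rational as ℚ using (mkℚ; toℚᵘ; ½; 0ℚ)
import Data.Rational.Properties as ℚP
open import Data.Rational.Unnormalised as ℚᵘ using (mkℚᵘ; _≃_)
import Data.Rational.Unnormalised.Properties as ℚᵘP
open import Data.Sum using (_⊎_; inj₁; inj₂; [_,_]; map₂)
open import Function using (_∘_; id; _⇔_; mk⇔; Equivalence)
open import Induction.WellFounded using (Acc; acc)
open import Relation.Nullary using (¬_; yes; no; contradiction)
open import Relation.Nullary.Decidable using (⌊_⌋; toWitness; fromWitness)
open import Relation.Binary.PropositionalEquality hiding ([_])

-- Counting Boolean predicates below a bound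

𝟙 : Bool → ℕ
𝟙 b = if b then 1 else 0

count : (ℕ → Bool) → ℕ → ℕ
count p zero    = 0
count p (suc N) = count p N + 𝟙 (p N)

count-cong : ∀ {p q} → p ≗ q → ∀ N → count p N ≡ count q N
count-cong p≗q zero    = refl
count-cong p≗q (suc N) = cong₂ _+_ (count-cong p≗q N) (cong 𝟙 (p≗q N))

count-mono : ∀ {p q} → (∀ y → T (p y) → T (q y)) → ∀ N → count p N ≤ count q N
count-mono p⇒q zero    = z≤n
count-mono p⇒q (suc N) = +-mono-≤ (count-mono p⇒q N) (𝟙-mono (p⇒q N))
  where
  𝟙-mono : ∀ {a b} → (T a → T b) → 𝟙 a ≤ 𝟙 b
  𝟙-mono {false}        _   = z≤n
  𝟙-mono {true} {true}  _   = ≤-refl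
  𝟙-mono {true} {false} a⇒b = ⊥-elim (a⇒b _)

count-union : ∀ {p q r} → (∀ y → T (p y) → T (q y) ⊎ T (r y)) →
              ∀ N → count p N ≤ count q N + count r N
count-union p⇒q∨r zero = z≤n
count-union {p} {q} {r} p⇒q∨r (suc N) = begin
  count p N + 𝟙 (p N)                          ≤⟨ +-mono-≤ (count-union p⇒q∨r N) (𝟙-union (p⇒q∨r N)) ⟩
  count q N + count r N + (𝟙 (q N) + 𝟙 (r N))  ≡⟨ interchange (count q N) (count r N) (𝟙 (q N)) (𝟙 (r N)) ⟩
  count q N + 𝟙 (q N) + (count r N + 𝟙 (r N))  ∎
  where
  open ≤-Reasoning
  𝟙-union : ∀ {a b c} → (T a → T b ⊎ T c) → 𝟙 a ≤ 𝟙 b + 𝟙 c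
  𝟙-union {false}                _ = z≤n
  𝟙-union {true} {true}          _ = s≤s z≤n
  𝟙-union {true} {false} {true}  _ = ≤-refl
  𝟙-union {true} {false} {false} a⇒b∨c with a⇒b∨c _
  ... | inj₁ ()
  ... | inj₂ ()

count-monoʳ : ∀ p {M N} → M ≤ N → count p M ≤ count p N
count-monoʳ p {N = zero}      z≤n = ≤-refl
count-monoʳ p {M} {suc N} M≤1+N with m≤n⇒m<n∨m≡n M≤1+N
... | inj₁ M<1+N = ≤-trans (count-monoʳ p (s≤s⁻¹ M<1+N)) (m≤m+n (count p N) _)
... | inj₂ refl  = ≤-refl

count-suc : ∀ p N → T (p N) → count p (suc N) ≡ suc (count p N)
count-suc p N pN with p N
count-suc p N _  | true = +-comm (count p N) 1
count-suc p N () | false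

count-shift : ∀ p N → count p (suc N) ≡ 𝟙 (p 0) + count (p ∘ suc) N
count-shift p zero    = +-comm 0 (𝟙 (p 0))
count-shift p (suc N) = trans (cong (_+ 𝟙 (p (suc N))) (count-shift p N)) (+-assoc (𝟙 (p 0)) _ _)

count-double : ∀ p N → count p (N * 2) ≡ count (λ z → p (z * 2)) N + count (λ z → p (1 + z * 2)) N
count-double p zero    = refl
count-double p (suc N) = begin
  count p (N * 2) + e + o    ≡⟨ +-assoc (count p (N * 2)) e o ⟩
  count p (N * 2) + (e + o)  ≡⟨ cong (_+ (e + o)) (count-double p N) ⟩
  E + O + (e + o)            ≡⟨ interchange E O e o ⟩
  E + e + (O + o)            ∎
  where
  open ≡-Reasoning
  E = count (λ z → p (z * 2)) N
  O = count (λ z → p (1 + z * 2)) N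
  e = 𝟙 (p (N * 2))
  o = 𝟙 (p (1 + N * 2))

count-alternating : ∀ p → (∀ z → p (z * 2) ≡ not (p (1 + z * 2))) → ∀ N → count p (N * 2) ≡ N
count-alternating p alt zero    = refl
count-alternating p alt (suc N) = begin
  count p (N * 2) + 𝟙 (p (N * 2)) + 𝟙 o    ≡⟨ +-assoc (count p (N * 2)) (𝟙 (p (N * 2))) (𝟙 o) ⟩
  count p (N * 2) + (𝟙 (p (N * 2)) + 𝟙 o)  ≡⟨ cong₂ _+_ (count-alternating p alt N) (cong (λ b → 𝟙 b + 𝟙 o) (alt N)) ⟩
  N + (𝟙 (not o) + 𝟙 o)                    ≡⟨ cong (N +_) (𝟙-not+𝟙 o) ⟩
  N + 1                                    ≡⟨ +-comm N 1 ⟩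
  suc N                                    ∎
  where
  open ≡-Reasoning
  o = p (1 + N * 2)
  𝟙-not+𝟙 : ∀ b → 𝟙 (not b) + 𝟙 b ≡ 1
  𝟙-not+𝟙 false = refl
  𝟙-not+𝟙 true  = refl

count-false : ∀ N → count (λ _ → false) N ≡ 0
count-false zero    = refl
count-false (suc N) = cong (_+ 0) (count-false N)

count-∧ : ∀ b p N → count (λ z → b ∧ p z) N ≡ 𝟙 b * count p N
count-∧ true  p N = sym (+-identityʳ (count p N))
count-∧ false p N = count-false N

count-unbounded : ∀ p (f : ℕ → ℕ) → (∀ j → f j < f (suc j)) → (∀ j → T (p (f j))) →
                  ∀ j → j < count p (suc (f j))
count-unbounded p f f↑ pf zero    = subst (0 <_) (sym (count-suc p (f 0) (pf 0))) (s≤s z≤n)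
count-unbounded p f f↑ pf (suc j) = begin-strict
  suc j                      ≤⟨ count-unbounded p f f↑ pf j ⟩
  count p (suc (f j))        ≤⟨ count-monoʳ p (f↑ j) ⟩
  count p (f (suc j))        <⟨ n<1+n _ ⟩
  suc (count p (f (suc j)))  ≡⟨ count-suc p (f (suc j)) (pf (suc j)) ⟨
  count p (suc (f (suc j)))  ∎
  where open ≤-Reasoning

-- The Ackermann coding

n<2^n : ∀ n → n < 2 ^ n
n<2^n zero    = s≤s z≤n
n<2^n (suc n) = begin-strict
  suc n          ≡⟨ +-comm 1 n ⟩
  n + 1          <⟨ +-mono-<-≤ (n<2^n n) (m^n>0 2 n) ⟩
  2 ^ n + 2 ^ n  ≡⟨ cong (2 ^ n +_) (+-identityʳ (2 ^ n)) ⟨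
  2 ^ suc n      ∎
  where open ≤-Reasoning

m≤tower : ∀ m → m ≤ tower m
m≤tower zero    = z≤n
m≤tower (suc m) = ≤-<-trans (m≤tower m) (n<2^n (tower m))

bit-even-0 : ∀ z → bit (z * 2) 0 ≡ false
bit-even-0 z = cong (_≡ᵇ 1) (m*n%n≡0 z 2)

bit-odd-0 : ∀ z → bit (1 + z * 2) 0 ≡ true
bit-odd-0 z = cong (_≡ᵇ 1) ([m+kn]%n≡m%n 1 z 2)

∅∈ₕ-alternates : ∀ z → bit (z * 2) 0 ≡ not (bit (1 + z * 2) 0)
∅∈ₕ-alternates z = trans (bit-even-0 z) (cong not (sym (bit-odd-0 z)))

count-∅∉ₕ : ∀ N → count (λ y → not (bit y 0)) (N * 2) ≡ N
count-∅∉ₕ = count-alternating (λ y → not (bit y 0)) (cong not ∘ ∅∈ₕ-alternates)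

even-half : ∀ z → z * 2 / 2 ≡ z
even-half z = m*n/n≡m z 2

odd-half : ∀ z → (1 + z * 2) / 2 ≡ z
odd-half z = trans (+-distrib-/-∣ʳ 1 {d = 2} (divides-refl z)) (m*n/n≡m z 2)

bit-even-suc : ∀ z x → bit (z * 2) (suc x) ≡ bit z x
bit-even-suc z x = cong (λ y → bit y x) (even-half z)

∉ₕ0 : ∀ x → ¬ x ∈ₕ 0
∉ₕ0 zero    ()
∉ₕ0 (suc x) = ∉ₕ0 x

∈ₕ2^⇒≡ : ∀ {x} k → x ∈ₕ (2 ^ k) → x ≡ k
∈ₕ2^⇒≡ {zero}  zero    _   = refl
∈ₕ2^⇒≡ {suc x} zero    x∈1 = ⊥-elim (∉ₕ0 x x∈1)
∈ₕ2^⇒≡ {zero}  (suc k) 0∈  =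
  contradiction (trans (sym (bit-even-0 (2 ^ k))) (subst (0 ∈ₕ_) (*-comm 2 (2 ^ k)) 0∈)) λ ()
∈ₕ2^⇒≡ {suc x} (suc k) x∈  =
  cong suc (∈ₕ2^⇒≡ k (trans (sym (bit-even-suc (2 ^ k) x)) (subst (suc x ∈ₕ_) (*-comm 2 (2 ^ k)) x∈)))

∈ₕ⇒2^≤ : ∀ {x y} → x ∈ₕ y → 2 ^ x ≤ y
∈ₕ⇒2^≤ {zero}  {suc y} _   = s≤s z≤n
∈ₕ⇒2^≤ {suc x} {y}     x∈y = begin
  2 ^ suc x  ≡⟨ *-comm 2 (2 ^ x) ⟩
  2 ^ x * 2  ≤⟨ *-monoˡ-≤ 2 (∈ₕ⇒2^≤ {x} {y / 2} x∈y) ⟩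
  y / 2 * 2  ≤⟨ m/n*n≤m y 2 ⟩
  y          ∎
  where open ≤-Reasoning

∈ₕ⇒< : ∀ {x y} → x ∈ₕ y → x < y
∈ₕ⇒< {x} x∈y = <-≤-trans (n<2^n x) (∈ₕ⇒2^≤ {x} x∈y)

∅∉ₕ⇒even : ∀ y → bit y 0 ≡ false → y ≡ y / 2 * 2
∅∉ₕ⇒even y 0∉y = trans (m≡m%n+[m/n]*n y 2) (cong (_+ y / 2 * 2) (parity (y % 2) (m%n<n y 2) 0∉y))
  where
  parity : ∀ r → r < 2 → (r ≡ᵇ 1) ≡ false → r ≡ 0
  parity zero          _                 _  = refl
  parity (suc zero)    _                 ()
  parity (suc (suc r)) (s≤s (s≤s ()))    _

nonzero⇒∃∈ₕ : ∀ {y} → y ≢ 0 → ∃ (_∈ₕ y)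
nonzero⇒∃∈ₕ {y} = go (<-wellFounded y)
  where
  go : ∀ {y} → Acc _<_ y → y ≢ 0 → ∃ (_∈ₕ y)
  go {y} (acc rec) y≢0 with bit y 0 in 0∈y
  ... | true  = 0 , 0∈y
  ... | false = Product.map suc id (go (rec y/2<y) y/2≢0)
    where
    y/2<y : y / 2 < y
    y/2<y = m/n<m y 2 {{≢-nonZero y≢0}} (s≤s (s≤s z≤n))
    y/2≢0 : y / 2 ≢ 0
    y/2≢0 y/2≡0 = y≢0 (trans (∅∉ₕ⇒even y 0∈y) (cong (_* 2) y/2≡0))

-- T (avoids d t y) holds iff no element i < t of y satisfies T (d i).
avoids : (ℕ → Bool) → ℕ → ℕ → Bool
avoids d zero    y = true
avoids d (suc t) y = not (bit y 0 ∧ d 0) ∧ avoids (d ∘ suc) t (y / 2)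

avoids⊎∈ₕ : ∀ d t y → T (avoids d t y) ⊎ ∃ λ i → T (d i) × i ∈ₕ y
avoids⊎∈ₕ d zero    y = inj₁ _
avoids⊎∈ₕ d (suc t) y with bit y 0 in 0∈y | d 0 in d0
... | true  | true  = inj₂ (0 , subst T (sym d0) _ , 0∈y)
... | true  | false = map₂ (Product.map suc id) (avoids⊎∈ₕ (d ∘ suc) t (y / 2))
... | false | _     = map₂ (Product.map suc id) (avoids⊎∈ₕ (d ∘ suc) t (y / 2))

count-avoids-double : ∀ d t N → count (avoids d (suc t)) (N * 2)
                              ≡ count (avoids (d ∘ suc) t) N + 𝟙 (not (d 0)) * count (avoids (d ∘ suc) t) N
count-avoids-double d t N = begin
  count (avoids d (suc t)) (N * 2)
    ≡⟨ count-double (avoids d (suc t)) N ⟩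
  count (λ z → avoids d (suc t) (z * 2)) N + count (λ z → avoids d (suc t) (1 + z * 2)) N
    ≡⟨ cong₂ _+_ (count-cong even N) (count-cong odd N) ⟩
  count (avoids (d ∘ suc) t) N + count (λ z → not (d 0) ∧ avoids (d ∘ suc) t z) N
    ≡⟨ cong (count (avoids (d ∘ suc) t) N +_) (count-∧ (not (d 0)) (avoids (d ∘ suc) t) N) ⟩
  count (avoids (d ∘ suc) t) N + 𝟙 (not (d 0)) * count (avoids (d ∘ suc) t) N ∎
  where
  open ≡-Reasoning
  even : ∀ z → avoids d (suc t) (z * 2) ≡ avoids (d ∘ suc) t z
  even z = cong₂ (λ b y → not (b ∧ d 0) ∧ avoids (d ∘ suc) t y) (bit-even-0 z) (even-half z)
  odd : ∀ z → avoids d (suc t) (1 + z * 2) ≡ not (d 0) ∧ avoids (d ∘ suc) t z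
  odd z = cong₂ (λ b y → not (b ∧ d 0) ∧ avoids (d ∘ suc) t y) (bit-odd-0 z) (odd-half z)

count-avoids : ∀ d t → 2 ^ count d t * count (avoids d t) (2 ^ t) ≡ 2 ^ t
count-avoids d zero    = refl
count-avoids d (suc t) = begin
  2 ^ count d (suc t) * count (avoids d (suc t)) (2 ^ suc t)
    ≡⟨ cong₂ (λ k N → 2 ^ k * count (avoids d (suc t)) N) (count-shift d t) (*-comm 2 (2 ^ t)) ⟩
  2 ^ (𝟙 (d 0) + K) * count (avoids d (suc t)) (2 ^ t * 2)
    ≡⟨ cong (2 ^ (𝟙 (d 0) + K) *_) (count-avoids-double d t (2 ^ t)) ⟩
  2 ^ (𝟙 (d 0) + K) * (Z + 𝟙 (not (d 0)) * Z)
    ≡⟨ halve-or-double (d 0) ⟩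
  2 * (2 ^ K * Z)
    ≡⟨ cong (2 *_) (count-avoids (d ∘ suc) t) ⟩
  2 ^ suc t ∎
  where
  open ≡-Reasoning
  K = count (d ∘ suc) t
  Z = count (avoids (d ∘ suc) t) (2 ^ t)
  halve-or-double : ∀ b → 2 ^ (𝟙 b + K) * (Z + 𝟙 (not b) * Z) ≡ 2 * (2 ^ K * Z)
  halve-or-double true  = trans (cong (2 ^ suc K *_) (+-identityʳ Z)) (*-assoc 2 (2 ^ K) Z)
  halve-or-double false = *-Comm.x∙yz≈y∙xz (2 ^ K) 2 Z

-- Winning sets of small rank

WinE-elim : ∀ {k x y} → WinE k y → x ∈ₕ y → AnyO k x
WinE-elim {k} {x} {y} w x∈y =
  subst (AnyO k) (toℕ-fromℕ< x<y) (w (fromℕ< x<y) (subst (_∈ₕ y) (sym (toℕ-fromℕ< x<y)) x∈y))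
  where x<y = ∈ₕ⇒< x∈y

WinO-intro : ∀ {k x y} → x ∈ₕ y → WinE k x → WinO k y
WinO-intro {k} {x} {y} x∈y w =
  fromℕ< x<y , subst (_∈ₕ y) (sym (toℕ-fromℕ< x<y)) x∈y , subst (WinE k) (sym (toℕ-fromℕ< x<y)) w
  where x<y = ∈ₕ⇒< x∈y

∈ₕ⇒¬WinE0 : ∀ {x y} → x ∈ₕ y → ¬ WinE 0 y
∈ₕ⇒¬WinE0 {x} x∈y w = WinE-elim {x = x} w x∈y

WinE0⇒≡0 : ∀ {y} → WinE 0 y → y ≡ 0
WinE0⇒≡0 {zero}  _ = refl
WinE0⇒≡0 {suc y} w with nonzero⇒∃∈ₕ {suc y} (λ ())
... | x , x∈y = ⊥-elim (∈ₕ⇒¬WinE0 {x} x∈y w)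

∅∈ₕ⇒WinO0 : ∀ {y} → 0 ∈ₕ y → WinO 0 y
∅∈ₕ⇒WinO0 0∈y = WinO-intro {x = 0} 0∈y λ ()

WinO0⇒∅∈ₕ : ∀ {y} → WinO 0 y → 0 ∈ₕ y
WinO0⇒∅∈ₕ {y} (x , x∈y , w) = subst (_∈ₕ y) (WinE0⇒≡0 w) x∈y

WinE1⇒¬WinO0 : ∀ {x} → WinE 1 x → ¬ WinO 0 x
WinE1⇒¬WinO0 w (z , z∈x , wz) with w z z∈x
... | inj₂ (z′ , z′∈z , _) = wz z′ z′∈z

∈ₕ-WinE1⇒¬WinE1 : ∀ {x y} → x ∈ₕ y → WinE 1 x → ¬ WinE 1 y
∈ₕ-WinE1⇒¬WinE1 {x} x∈y wx wy with WinE-elim {x = x} wy x∈y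
... | inj₂ x-wins = WinE1⇒¬WinO0 wx x-wins

-- 2 ^ k codes {k}, and the odd number 1 + j * 2 codes a set containing ∅.
WinE1-2^odd : ∀ j → WinE 1 (2 ^ (1 + j * 2))
WinE1-2^odd j z z∈ = inj₂ (∅∈ₕ⇒WinO0 (subst (0 ∈ₕ_) (sym (∈ₕ2^⇒≡ {toℕ z} (1 + j * 2) z∈)) (bit-odd-0 j)))

S1⇔∅∈ₕ : ∀ {y} → S 1 y ⇔ 0 ∈ₕ y
S1⇔∅∈ₕ = mk⇔ (WinO0⇒∅∈ₕ ∘ proj₁) λ 0∈y → ∅∈ₕ⇒WinO0 0∈y , λ { zero → ∈ₕ⇒¬WinE0 {0} 0∈y }

S3⇒∅∉ₕ : ∀ {y} → S 3 y → ¬ 0 ∈ₕ y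
S3⇒∅∉ₕ s 0∈y = proj₂ s (suc zero) (∅∈ₕ⇒WinO0 0∈y)

∈ₕ-WinE1-S⇒1⊎3 : ∀ n {x y} → x ∈ₕ y → WinE 1 x → S n y → n ≡ 1 ⊎ n ≡ 3
∈ₕ-WinE1-S⇒1⊎3 0 {x} x∈y wx s = ⊥-elim (∈ₕ⇒¬WinE0 {x} x∈y (proj₁ s))
∈ₕ-WinE1-S⇒1⊎3 1 x∈y wx s = inj₁ refl
∈ₕ-WinE1-S⇒1⊎3 2 x∈y wx s = ⊥-elim (∈ₕ-WinE1⇒¬WinE1 x∈y wx (proj₁ s))
∈ₕ-WinE1-S⇒1⊎3 3 x∈y wx s = inj₂ refl
∈ₕ-WinE1-S⇒1⊎3 (suc (suc (suc (suc n)))) x∈y wx s = ⊥-elim (proj₂ s (suc (suc (suc zero))) (WinO-intro x∈y wx))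

∈ₕ-WinE1-∅∉ₕ⇒S3 : ∀ {x y} → x ∈ₕ y → WinE 1 x → ¬ 0 ∈ₕ y → S 3 y
∈ₕ-WinE1-∅∉ₕ⇒S3 {x} x∈y wx 0∉y = WinO-intro x∈y wx , λ
  { zero             → ∈ₕ⇒¬WinE0 {x} x∈y
  ; (suc zero)       → 0∉y ∘ WinO0⇒∅∈ₕ
  ; (suc (suc zero)) → ∈ₕ-WinE1⇒¬WinE1 x∈y wx
  }

-- Counting the classes S n

isWinE1 : ℕ → Bool
isWinE1 x = ⌊ WinE? 1 x ⌋

countS≡count : ∀ n N → countS n N ≡ count (λ y → ⌊ S? n y ⌋) N
countS≡count n zero    = refl
countS≡count n (suc N) = cong (_+ 𝟙 ⌊ S? n N ⌋) (countS≡count n N)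

countS1 : ∀ N → countS 1 (N * 2) ≡ N
countS1 N = begin
  countS 1 (N * 2)                  ≡⟨ countS≡count 1 (N * 2) ⟩
  count (λ y → ⌊ S? 1 y ⌋) (N * 2)  ≡⟨ count-cong S1≗∅∈ₕ (N * 2) ⟩
  count (λ y → bit y 0) (N * 2)     ≡⟨ count-alternating (λ y → bit y 0) ∅∈ₕ-alternates N ⟩
  N                                 ∎
  where
  open ≡-Reasoning
  S1≗∅∈ₕ : ∀ y → ⌊ S? 1 y ⌋ ≡ bit y 0
  S1≗∅∈ₕ y with S? 1 y | bit y 0 in 0∈y
  ... | yes _  | true  = refl
  ... | yes s  | false = contradiction (trans (sym 0∈y) (Equivalence.to S1⇔∅∈ₕ s)) λ ()
  ... | no  _  | false = refl
  ... | no  ¬s | true  = contradiction (Equivalence.from S1⇔∅∈ₕ 0∈y) ¬s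

countS3≤ : ∀ N → countS 3 (N * 2) ≤ N
countS3≤ N = begin
  countS 3 (N * 2)                      ≡⟨ countS≡count 3 (N * 2) ⟩
  count (λ y → ⌊ S? 3 y ⌋) (N * 2)      ≤⟨ count-mono S3⇒∅∉ₕᵇ (N * 2) ⟩
  count (λ y → not (bit y 0)) (N * 2)   ≡⟨ count-∅∉ₕ N ⟩
  N                                     ∎
  where
  open ≤-Reasoning
  S3⇒∅∉ₕᵇ : ∀ y → T ⌊ S? 3 y ⌋ → T (not (bit y 0))
  S3⇒∅∉ₕᵇ y s = Equivalence.from T-not-≡ (¬-not (S3⇒∅∉ₕ (toWitness s)))

≤countS3+avoiders : ∀ N t → N ≤ countS 3 (N * 2) + count (avoids isWinE1 t) (N * 2)
≤countS3+avoiders N t = begin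
  N
    ≡⟨ count-∅∉ₕ N ⟨
  count (λ y → not (bit y 0)) (N * 2)
    ≤⟨ count-union S3-or-avoids (N * 2) ⟩
  count (λ y → ⌊ S? 3 y ⌋) (N * 2) + count (avoids isWinE1 t) (N * 2)
    ≡⟨ cong (_+ count (avoids isWinE1 t) (N * 2)) (countS≡count 3 (N * 2)) ⟨
  countS 3 (N * 2) + count (avoids isWinE1 t) (N * 2)
    ∎
  where
  open ≤-Reasoning
  S3-or-avoids : ∀ y → T (not (bit y 0)) → T ⌊ S? 3 y ⌋ ⊎ T (avoids isWinE1 t y)
  S3-or-avoids y 0∉y with avoids⊎∈ₕ isWinE1 t y
  ... | inj₁ avoiding       = inj₂ avoiding
  ... | inj₂ (i , wi , i∈y) = inj₁ (fromWitness
          (∈ₕ-WinE1-∅∉ₕ⇒S3 {i} i∈y (toWitness {a? = WinE? 1 i} wi) (not-¬ (Equivalence.to T-not-≡ 0∉y))))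

countS≤avoiders : ∀ n → n ≢ 1 → n ≢ 3 → ∀ N t → countS n N ≤ count (avoids isWinE1 t) N
countS≤avoiders n n≢1 n≢3 N t = ≤-trans (≤-reflexive (countS≡count n N)) (count-mono S⇒avoids N)
  where
  S⇒avoids : ∀ y → T ⌊ S? n y ⌋ → T (avoids isWinE1 t y)
  S⇒avoids y s with avoids⊎∈ₕ isWinE1 t y
  ... | inj₁ avoiding       = avoiding
  ... | inj₂ (i , wi , i∈y) =
    ⊥-elim ([ n≢1 , n≢3 ] (∈ₕ-WinE1-S⇒1⊎3 n {i} i∈y (toWitness {a? = WinE? 1 i} wi) (toWitness s)))

count-isWinE1-unbounded : ∀ q t → suc (2 ^ (1 + q * 2)) ≤ t → q < count isWinE1 t
count-isWinE1-unbounded q t t-large =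
  <-≤-trans (count-unbounded isWinE1 f f↑ f-wins q) (count-monoʳ isWinE1 t-large)
  where
  f : ℕ → ℕ
  f j = 2 ^ (1 + j * 2)
  f↑ : ∀ j → f j < f (suc j)
  f↑ j = ^-monoʳ-< 2 (s≤s (s≤s z≤n)) (n≤1+n (suc (suc (j * 2))))
  f-wins : ∀ j → T (isWinE1 (f j))
  f-wins j = fromWitness {a? = WinE? 1 (f j)} (WinE1-2^odd j)

avoiders-few : ∀ q t → q < count isWinE1 t → count (avoids isWinE1 t) (2 ^ t) * suc q < 2 ^ t
avoiders-few q t q<K = begin-strict
  Z * suc q  <⟨ *-monoʳ-< Z {{≢-nonZero Z≢0}} (≤-<-trans q<K (n<2^n K)) ⟩
  Z * 2 ^ K  ≡⟨ *-comm Z (2 ^ K) ⟩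
  2 ^ K * Z  ≡⟨ count-avoids isWinE1 t ⟩
  2 ^ t      ∎
  where
  open ≤-Reasoning
  K = count isWinE1 t
  Z = count (avoids isWinE1 t) (2 ^ t)
  Z≢0 : Z ≢ 0
  Z≢0 Z≡0 = m<n⇒n≢0 (m^n>0 2 t) (begin-equality
    2 ^ t      ≡⟨ count-avoids isWinE1 t ⟨
    2 ^ K * Z  ≡⟨ cong (2 ^ K *_) Z≡0 ⟩
    2 ^ K * 0  ≡⟨ *-zeroʳ (2 ^ K) ⟩
    0          ∎)

-- Convergence of fractions

∣m⊖n∣≡∣m-n∣ : ∀ m n → ℤ.∣ m ⊖ n ∣ ≡ ∣ m - n ∣
∣m⊖n∣≡∣m-n∣ m n with ≤-total m n
... | inj₁ m≤n = trans (ℤP.∣⊖∣-≤ m≤n) (sym (m≤n⇒∣m-n∣≡n∸m m≤n))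
... | inj₂ n≤m = trans (cong ℤ.∣_∣ (ℤP.⊖-≥ n≤m)) (sym (m≤n⇒∣n-m∣≡n∸m n≤m))

∣+a*+e-+b*+d∣≡∣a*e-b*d∣ : ∀ a e b d →
  ℤ.∣ ℤ.+ a ℤ.* ℤ.+ e ℤ.+ ℤ.- (ℤ.+ b) ℤ.* ℤ.+ d ∣ ≡ ∣ a * e - b * d ∣
∣+a*+e-+b*+d∣≡∣a*e-b*d∣ a e b d = begin
  ℤ.∣ ℤ.+ a ℤ.* ℤ.+ e ℤ.+ ℤ.- (ℤ.+ b) ℤ.* ℤ.+ d ∣
    ≡⟨ cong₂ (λ u v → ℤ.∣ u ℤ.+ v ∣) (sym (ℤP.pos-* a e))
             (trans (sym (ℤP.neg-distribˡ-* (ℤ.+ b) (ℤ.+ d))) (cong ℤ.-_ (sym (ℤP.pos-* b d)))) ⟩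
  ℤ.∣ ℤ.+ (a * e) ℤ.- ℤ.+ (b * d) ∣  ≡⟨ cong ℤ.∣_∣ (ℤP.m-n≡m⊖n (a * e) (b * d)) ⟩
  ℤ.∣ (a * e) ⊖ (b * d) ∣            ≡⟨ ∣m⊖n∣≡∣m-n∣ (a * e) (b * d) ⟩
  ∣ a * e - b * d ∣                  ∎
  where open ≡-Reasoning

-- The comparison is made in ℚᵘ, where p′ - r′ is literally
-- (a (E + 1) - b (D + 1)) / ((D + 1) (E + 1)).
∣frac-frac∣< : ∀ a D b E {c q} .{cop : Coprime (suc c) (suc q)} →
               ∣ a * suc E - b * suc D ∣ * suc q < suc c * (suc D * suc E) →
               ℚ.∣ frac a (suc D) ℚ.- frac b (suc E) ∣ ℚ.< mkℚ +[1+ c ] q cop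
∣frac-frac∣< a D b E {c} {q} {cop} close = ℚP.toℚᵘ-cancel-< (begin-strict
  toℚᵘ ℚ.∣ p ℚ.- r ∣                ≃⟨ ℚP.toℚᵘ-homo-∣-∣ (p ℚ.- r) ⟩
  ℚᵘ.∣ toℚᵘ (p ℚ.- r) ∣             ≃⟨ ℚᵘP.∣-∣-cong (ℚP.toℚᵘ-homo-+ p (ℚ.- r)) ⟩
  ℚᵘ.∣ toℚᵘ p ℚᵘ.+ toℚᵘ (ℚ.- r) ∣   ≃⟨ ℚᵘP.∣-∣-cong (ℚᵘP.+-cong (ℚP.toℚᵘ-fromℚᵘ p′) toℚᵘ-−r) ⟩
  ℚᵘ.∣ p′ ℚᵘ.- r′ ∣                 <⟨ ℚᵘ.*<* cross-multiplied ⟩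
  toℚᵘ (mkℚ +[1+ c ] q cop)         ∎)
  where
  open ℚᵘP.≤-Reasoning
  p′ = mkℚᵘ (ℤ.+ a) D
  r′ = mkℚᵘ (ℤ.+ b) E
  p = frac a (suc D)
  r = frac b (suc E)
  toℚᵘ-−r : toℚᵘ (ℚ.- r) ≃ ℚᵘ.- r′
  toℚᵘ-−r = ℚᵘP.≃-trans (ℚP.toℚᵘ-homo‿- r) (ℚᵘP.-‿cong (ℚP.toℚᵘ-fromℚᵘ r′))
  X : ℤ.ℤ
  X = ℤ.+ a ℤ.* ℤ.+ suc E ℤ.+ ℤ.- (ℤ.+ b) ℤ.* ℤ.+ suc D
  cross-multiplied : ℤ.+ ℤ.∣ X ∣ ℤ.* ℤ.+ suc q ℤ.< +[1+ c ] ℤ.* ℤ.+ (suc D * suc E)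
  cross-multiplied =
    subst₂ ℤ._<_ (trans (cong (λ u → ℤ.+ (u * suc q)) (sym (∣+a*+e-+b*+d∣≡∣a*e-b*d∣ a (suc E) b (suc D))))
                        (ℤP.pos-* ℤ.∣ X ∣ (suc q)))
                 (ℤP.pos-* (suc c) (suc D * suc E))
                 (ℤ.+<+ close)

Tends-frac : ∀ (a D : ℕ → ℕ) b e →
             (∀ q → ∃ λ M → ∀ m → M ≤ m → ∣ a m * suc e - b * D m ∣ * suc q < D m * suc e) →
             Tends (λ m → frac (a m) (D m)) (frac b (suc e))
Tends-frac a D b e close (mkℚ +[1+ c ] q cop) _ =
  proj₁ (close q) , λ m M≤m → <ε (a m) (D m) (proj₂ (close q) m M≤m)
  where
  <ε : ∀ x d → ∣ x * suc e - b * d ∣ * suc q < d * suc e →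
       ℚ.∣ frac x d ℚ.- frac b (suc e) ∣ ℚ.< mkℚ +[1+ c ] q cop
  <ε x zero    ()
  <ε x (suc d) x/d-close = ∣frac-frac∣< x d b e (<-≤-trans x/d-close (m≤n*m _ (suc c)))
Tends-frac a D b e close (mkℚ (ℤ.+ 0) _ _) (ℚ.*<* (ℤ.+<+ ()))
Tends-frac a D b e close (mkℚ -[1+ _ ] _ _) (ℚ.*<* ())

-- Cross-multiplied form of  |countS n M / M - b / (1 + e)| ≤ A / M  for even M,
-- where A counts the y < M having no 2-winning element below t.
AvoidersBound : ℕ → ℕ → ℕ → Set
AvoidersBound n b e = ∀ N t →
  ∣ countS n (N * 2) * suc e - b * (N * 2) ∣ ≤ count (avoids isWinE1 t) (N * 2) * suc e

Tends-ratio : ∀ n b e → AvoidersBound n b e → Tends (ratio n) (frac b (suc e))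
Tends-ratio n b e bound = Tends-frac (countS n ∘ tower) tower b e λ q →
  suc (t₀ q) , λ { (suc m) (s≤s t₀≤m) → close q (tower m) (≤-trans t₀≤m (m≤tower m)) }
  where
  -- beyond the 2-winning positions 2 ^ (1 + j * 2), j ≤ q
  t₀ : ℕ → ℕ
  t₀ q = suc (2 ^ (1 + q * 2))
  close : ∀ q t → t₀ q ≤ t → ∣ countS n (2 ^ t) * suc e - b * 2 ^ t ∣ * suc q < 2 ^ t * suc e
  close q zero    ()
  close q (suc t) t-large = begin-strict
    ∣ countS n (2 ^ suc t) * suc e - b * 2 ^ suc t ∣ * suc q
      ≡⟨ cong (λ N → ∣ countS n N * suc e - b * N ∣ * suc q) (*-comm 2 (2 ^ t)) ⟩
    ∣ countS n (2 ^ t * 2) * suc e - b * (2 ^ t * 2) ∣ * suc q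
      ≤⟨ *-monoˡ-≤ (suc q) (bound (2 ^ t) (suc t)) ⟩
    count (avoids isWinE1 (suc t)) (2 ^ t * 2) * suc e * suc q
      ≡⟨ cong (λ N → count (avoids isWinE1 (suc t)) N * suc e * suc q) (*-comm (2 ^ t) 2) ⟩
    Z * suc e * suc q
      ≡⟨ *-Comm.xy∙z≈xz∙y Z (suc e) (suc q) ⟩
    Z * suc q * suc e
      <⟨ *-monoˡ-< (suc e) (avoiders-few q (suc t) (count-isWinE1-unbounded q (suc t) t-large)) ⟩
    2 ^ suc t * suc e ∎
    where
    open ≤-Reasoning
    Z = count (avoids isWinE1 (suc t)) (2 ^ suc t)

countS1-bound : AvoidersBound 1 1 1
countS1-bound N t = ≤-trans (≤-reflexive (m≡n⇒∣m-n∣≡0 countS1*2≡N*2)) z≤n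
  where
  countS1*2≡N*2 : countS 1 (N * 2) * 2 ≡ 1 * (N * 2)
  countS1*2≡N*2 = trans (cong (_* 2) (countS1 N)) (sym (*-identityˡ (N * 2)))

countS3-bound : AvoidersBound 3 1 1
countS3-bound N t = begin
  ∣ countS 3 (N * 2) * 2 - 1 * (N * 2) ∣
    ≡⟨ cong (λ M → ∣ countS 3 (N * 2) * 2 - M ∣) (*-identityˡ (N * 2)) ⟩
  ∣ countS 3 (N * 2) * 2 - N * 2 ∣
    ≡⟨ *-distribʳ-∣-∣ 2 (countS 3 (N * 2)) N ⟨
  ∣ countS 3 (N * 2) - N ∣ * 2
    ≡⟨ cong (_* 2) (m≤n⇒∣m-n∣≡n∸m (countS3≤ N)) ⟩
  (N ∸ countS 3 (N * 2)) * 2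
    ≤⟨ *-monoˡ-≤ 2 (m≤n+o⇒m∸n≤o N (countS 3 (N * 2)) (≤countS3+avoiders N t)) ⟩
  count (avoids isWinE1 t) (N * 2) * 2
    ∎
  where open ≤-Reasoning

countS-bound : ∀ n → n ≢ 1 → n ≢ 3 → AvoidersBound n 0 0
countS-bound n n≢1 n≢3 N t = begin
  ∣ countS n (N * 2) * 1 - 0 ∣        ≡⟨ ∣-∣-identityʳ (countS n (N * 2) * 1) ⟩
  countS n (N * 2) * 1                ≤⟨ *-monoˡ-≤ 1 (countS≤avoiders n n≢1 n≢3 (N * 2) t) ⟩
  count (avoids isWinE1 t) (N * 2) * 1 ∎
  where open ≤-Reasoning

-- ½ and 0ℚ are frac 1 2 and frac 0 1 by definition.
theorem2 : ((n : ℕ) → (n ≡ 1 ⊎ n ≡ 3) → Tends (ratio n) ½)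
    × ((n : ℕ) → n ≢ 1 → n ≢ 3 → Tends (ratio n) 0ℚ)
theorem2 = (λ { _ (inj₁ refl) → Tends-ratio 1 1 1 countS1-bound
              ; _ (inj₂ refl) → Tends-ratio 3 1 1 countS3-bound })
         , λ n n≢1 n≢3 → Tends-ratio n 0 0 (countS-bound n n≢1 n≢3)
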